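{- Let $\mathcal{U}$ be a fine ultrafilter on $[V]^{<\mathrm{Card}}$ such that $\mathcal{U}\upharpoonright\omega=\{X\cap[V]^{<\omega}:X\in\mathcal{U}\}$ is an ultrafilter on $[V]^{<\omega}$. Then $[V]^{<\omega}\in\mathcal{U}$.
   Context: $V$ is the set-theoretic universe; $[V]^{<\mathrm{Card}}$ is the collection of all subsets of $V$ that are sets, and $[V]^{<\omega}$ is the collection of finite subsets of $V$. Ultrafilters on these collections are class ultrafilters. An ultrafilter $\mathcal{U}$ on $[V]^{<\mathrm{Card}}$ is fine if for every $x\in V$, $\{T\in[V]^{<\mathrm{Card}}: x\in T\}\in\mathcal{U}$. -}

module Defs where

open import Level using (Level; 0ℓ) renaming (suc to lsuc)
open import Data.Nat using (ℕ)
open import Data.Fin using (Fin)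
open import Data.Product using (Σ; _×_; _,_; ∃)
open import Data.Sum using (_⊎_)
open import Data.Empty using (⊥)
open import Level using (Lift)
open import Data.Unit using (⊤)
open import Relation.Nullary using (¬_)

-- The set-theoretic universe V, modelled (Aczel) as well-founded trees:
-- a set is given by an index type together with its family of elements.
data V : Set₁ where
  sup : (I : Set) → (I → V) → V

_≅_ : V → V → Set
sup I f ≅ sup J g =
  ((i : I) → Σ J λ j → f i ≅ g j) × ((j : J) → Σ I λ i → f i ≅ g j)

_∈V_ : V → V → Set
x ∈V sup I f = Σ I λ i → x ≅ f i

IsFinite : V → Set₁
IsFinite x = Σ ℕ λ n → Σ (Fin n → V) λ h →
  ((i : Fin n) → h i ∈V x) × ((y : V) → y ∈V x → Σ (Fin n) λ i → y ≅ h i)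

Class : Set₂
Class = V → Set₁

ClassFamily : Set₃
ClassFamily = Class → Set₂

_⊆_ : Class → Class → Set₁
X ⊆ Y = (x : V) → X x → Y x

_∩_ : Class → Class → Class
(X ∩ Y) x = X x × Y x

_∖_ : Class → Class → Class
(X ∖ Y) x = X x × ¬ Y x

∅ : Class
∅ _ = Lift _ ⊥

-- the class of all sets: [V]^{<Card} (every subset of V which is a set is an element of V)
AllSets : Class
AllSets _ = Lift _ ⊤

FinSets : Class
FinSets = IsFinite

record IsUltrafilterOn (D : Class) (F : ClassFamily) : Set₃ where
  field
    within   : (X : Class) → F X → X ⊆ D
    top      : F D
    proper   : ¬ F ∅
    upward   : (X Y : Class) → F X → X ⊆ Y → Y ⊆ D → F Y
    meet     : (X Y : Class) → F X → F Y → F (X ∩ Y)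
    ultra    : (X : Class) → X ⊆ D → F X ⊎ F (D ∖ X)

IsFine : ClassFamily → Set₂
IsFine U = (x : V) → U (λ T → Lift _ (x ∈V T))

-- the restriction U ↾ ω = { X ∩ [V]^{<ω} : X ∈ U }
-- (equality of classes taken extensionally, pointwise logical equivalence)
_↾ω : ClassFamily → ClassFamily
(U ↾ω) W = Σ Class λ X → U X ×
  ((T : V) → (W T → (X ∩ FinSets) T) × ((X ∩ FinSets) T → W T))

module Submission where

-- Since U is an ultrafilter on the class of all sets, it
-- contains either the class FinSets of finite sets or its complement
-- AllSets ∖ FinSets, the class of infinite sets.  The second alternative is
-- impossible: the infinite sets meet FinSets in nothing, so the trace of
-- that member of U on FinSets is the empty class, which would then belong
-- to U ↾ ω, contradicting that U ↾ ω is a proper filter on FinSets.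

open import Defs
open import Level using (lift)
open import Data.Product using (_,_)
open import Data.Sum using (inj₁; inj₂)
open import Data.Empty using (⊥-elim)
open import Relation.Nullary using (¬_)

Disjoint : Class → Set₁
Disjoint X = (T : V) → X T → ¬ FinSets T

emptyInRestriction : (U : ClassFamily) (X : Class) → U X → Disjoint X → (U ↾ω) ∅
emptyInRestriction U X X∈U disjoint =
  X , X∈U , λ T → (λ { (lift ()) }) , λ { (xT , finT) → lift (disjoint T xT finT) }

infiniteSetsDisjoint : Disjoint (AllSets ∖ FinSets)
infiniteSetsDisjoint T (_ , notFinite) = notFinite

proposition10 : (U : ClassFamily) → IsUltrafilterOn AllSets U → IsFine U
    → IsUltrafilterOn FinSets (U ↾ω) → U FinSets
proposition10 U uU _ uω with IsUltrafilterOn.ultra uU FinSets (λ _ _ → lift _)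
... | inj₁ finSets∈U = finSets∈U
... | inj₂ infSets∈U = ⊥-elim (IsUltrafilterOn.proper uω
        (emptyInRestriction U (AllSets ∖ FinSets) infSets∈U infiniteSetsDisjoint))
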